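{- There exists an $(m,4,3)$-PSDS for every integer $m$ with $5\leq m\leq 16$.
   Context: Let $m,k,c$ be positive integers. An $(m,k,c)$-perfect system of difference sets (PSDS) is a collection $\mathcal A$ of $m$ sets of nonnegative integers, each of size $k$, such that the multiset $\bigcup_{A\in\mathcal A}\{x-y: x,y\in A,\ x>y\}$ covers every element of $\{c,c+1,\dots,c-1+m\binom{k}{2}\}$ exactly once. -}

module Defs where

open import Data.Nat using (ℕ; _+_; _*_; _∸_; _<_)
open import Data.Nat.Combinatorics using (_C_)
open import Data.List using (List; []; _∷_; map; concatMap; length; _++_)
open import Data.List.Relation.Unary.All using (All)
open import Data.List.Relation.Binary.Permutation.Propositional using (_↭_)
open import Relation.Binary.PropositionalEquality using (_≡_)

-- A finite set of naturals is represented as a list in strictly increasing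
-- order (this is a canonical representation of a finite set; its size is
-- the length of the list).
data StrictlyIncreasing : List ℕ → Set where
  []  : StrictlyIncreasing []
  _∷_ : ∀ {x xs} → All (x <_) xs → StrictlyIncreasing xs → StrictlyIncreasing (x ∷ xs)

differences : List ℕ → List ℕ
differences []       = []
differences (x ∷ xs) = map (λ z → z ∸ x) xs ++ differences xs

range : ℕ → ℕ → List ℕ
range c 0       = []
range c (ℕ.suc n) = c ∷ range (ℕ.suc c) n

record PSDS (m k c : ℕ) (𝒜 : List (List ℕ)) : Set where
  field
    count      : length 𝒜 ≡ m
    sets       : All StrictlyIncreasing 𝒜
    sizes      : All (λ A → length A ≡ k) 𝒜
    perfect    : concatMap differences 𝒜 ↭ range c (m * (k C 2))

{-# OPTIONS --safe #-}
-- Each case is witnessed by an explicit system of four-element sets. Checking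
-- it is a finite computation: the difference multiset is a permutation of the
-- required interval as soon as insertion sort turns it into that interval,
-- which is already sorted.
module Submission where

open import Defs
open import Data.Nat using (ℕ; _≤_; _<_; _+_; _*_; _<?_; _≟_; s≤s)
open import Data.Nat.Properties using (≤-decTotalOrder; ∸-monoˡ-≤; m+[n∸m]≡n)
open import Data.Nat.Combinatorics using (_C_)
open import Data.List using (List; []; _∷_; length; concatMap; applyUpTo)
open import Data.List.Membership.Propositional.Properties using (∈-applyUpTo⁺)
open import Data.List.Relation.Unary.All as All using (All; []; _∷_; all?)
open import Data.List.Relation.Unary.AllPairs using (AllPairs; []; _∷_; allPairs?)
open import Data.List.Relation.Binary.Permutation.Propositional using (_↭_; ↭-sym; ↭-trans; ↭-reflexive)
-- Not Data.List.Sort: its algorithm is abstract, so it does not reduce on closed lists.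
open import Data.List.Sort.InsertionSort.Base ≤-decTotalOrder using (sort)
open import Data.List.Sort.InsertionSort.Properties ≤-decTotalOrder using (sort-↭)
open import Data.Product using (Σ; _,_)
open import Relation.Nullary.Decidable using (Dec; True; toWitness; map′)
open import Relation.Binary.PropositionalEquality using (_≡_; refl; subst)

strictlyIncreasing⇒allPairs : ∀ {xs} → StrictlyIncreasing xs → AllPairs _<_ xs
strictlyIncreasing⇒allPairs []          = []
strictlyIncreasing⇒allPairs (x< ∷ xs↑) = x< ∷ strictlyIncreasing⇒allPairs xs↑

allPairs⇒strictlyIncreasing : ∀ {xs} → AllPairs _<_ xs → StrictlyIncreasing xs
allPairs⇒strictlyIncreasing []          = []
allPairs⇒strictlyIncreasing (x< ∷ xs<) = x< ∷ allPairs⇒strictlyIncreasing xs<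

strictlyIncreasing? : (xs : List ℕ) → Dec (StrictlyIncreasing xs)
strictlyIncreasing? xs =
  map′ allPairs⇒strictlyIncreasing strictlyIncreasing⇒allPairs (allPairs? _<?_ xs)

sort≡⇒↭ : ∀ {xs ys} → sort xs ≡ ys → xs ↭ ys
sort≡⇒↭ {xs} sort-xs≡ys = ↭-trans (↭-sym (sort-↭ xs)) (↭-reflexive sort-xs≡ys)

psds-bySorting : ∀ {m k c} (𝒜 : List (List ℕ)) → length 𝒜 ≡ m
               → {_ : True (all? strictlyIncreasing? 𝒜)}
               → {_ : True (all? (λ A → length A ≟ k) 𝒜)}
               → sort (concatMap differences 𝒜) ≡ range c (m * (k C 2))
               → PSDS m k c 𝒜
psds-bySorting 𝒜 count {increasing} {sized} sorted = record
  { count   = count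
  ; sets    = toWitness increasing
  ; sizes   = toWitness sized
  ; perfect = sort≡⇒↭ sorted
  }

⟨0,_,_,_⟩ : ℕ → ℕ → ℕ → List ℕ
⟨0, a , b , c ⟩ = 0 ∷ a ∷ b ∷ c ∷ []

PSDS-4-3 : ℕ → Set
PSDS-4-3 m = Σ (List (List ℕ)) (PSDS m 4 3)

system₅ : List (List ℕ)
system₅ =
  ⟨0, 11 , 27 , 30 ⟩ ∷ ⟨0, 8 , 25 , 29 ⟩ ∷ ⟨0, 7 , 22 , 31 ⟩ ∷ ⟨0, 10 , 23 , 28 ⟩ ∷
  ⟨0, 12 , 26 , 32 ⟩ ∷ []

system₆ : List (List ℕ)
system₆ =
  ⟨0, 10 , 30 , 36 ⟩ ∷ ⟨0, 8 , 31 , 35 ⟩ ∷ ⟨0, 9 , 24 , 38 ⟩ ∷ ⟨0, 11 , 28 , 33 ⟩ ∷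
  ⟨0, 7 , 19 , 32 ⟩ ∷ ⟨0, 3 , 21 , 37 ⟩ ∷ []

system₇ : List (List ℕ)
system₇ =
  ⟨0, 23 , 32 , 42 ⟩ ∷ ⟨0, 14 , 34 , 40 ⟩ ∷ ⟨0, 7 , 25 , 37 ⟩ ∷ ⟨0, 22 , 39 , 43 ⟩ ∷
  ⟨0, 3 , 27 , 38 ⟩ ∷ ⟨0, 8 , 36 , 41 ⟩ ∷ ⟨0, 15 , 31 , 44 ⟩ ∷ []

system₈ : List (List ℕ)
system₈ =
  ⟨0, 7 , 32 , 48 ⟩ ∷ ⟨0, 8 , 22 , 46 ⟩ ∷ ⟨0, 3 , 40 , 45 ⟩ ∷ ⟨0, 12 , 23 , 43 ⟩ ∷
  ⟨0, 18 , 28 , 47 ⟩ ∷ ⟨0, 15 , 36 , 49 ⟩ ∷ ⟨0, 17 , 44 , 50 ⟩ ∷ ⟨0, 4 , 30 , 39 ⟩ ∷ []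

system₉ : List (List ℕ)
system₉ =
  ⟨0, 23 , 29 , 54 ⟩ ∷ ⟨0, 18 , 28 , 50 ⟩ ∷ ⟨0, 12 , 38 , 55 ⟩ ∷ ⟨0, 5 , 45 , 52 ⟩ ∷
  ⟨0, 15 , 36 , 56 ⟩ ∷ ⟨0, 14 , 27 , 51 ⟩ ∷ ⟨0, 4 , 39 , 48 ⟩ ∷ ⟨0, 11 , 19 , 53 ⟩ ∷
  ⟨0, 3 , 33 , 49 ⟩ ∷ []

system₁₀ : List (List ℕ)
system₁₀ =
  ⟨0, 29 , 34 , 60 ⟩ ∷ ⟨0, 13 , 21 , 56 ⟩ ∷ ⟨0, 17 , 49 , 53 ⟩ ∷ ⟨0, 7 , 47 , 59 ⟩ ∷
  ⟨0, 20 , 50 , 61 ⟩ ∷ ⟨0, 18 , 46 , 62 ⟩ ∷ ⟨0, 27 , 37 , 51 ⟩ ∷ ⟨0, 3 , 25 , 58 ⟩ ∷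
  ⟨0, 15 , 38 , 57 ⟩ ∷ ⟨0, 9 , 48 , 54 ⟩ ∷ []

system₁₁ : List (List ℕ)
system₁₁ =
  ⟨0, 14 , 61 , 66 ⟩ ∷ ⟨0, 19 , 53 , 62 ⟩ ∷ ⟨0, 10 , 30 , 65 ⟩ ∷ ⟨0, 7 , 36 , 58 ⟩ ∷
  ⟨0, 37 , 50 , 68 ⟩ ∷ ⟨0, 6 , 44 , 60 ⟩ ∷ ⟨0, 23 , 49 , 64 ⟩ ∷ ⟨0, 25 , 33 , 57 ⟩ ∷
  ⟨0, 3 , 48 , 59 ⟩ ∷ ⟨0, 27 , 39 , 67 ⟩ ∷ ⟨0, 42 , 46 , 63 ⟩ ∷ []

system₁₂ : List (List ℕ)
system₁₂ =
  ⟨0, 24 , 47 , 72 ⟩ ∷ ⟨0, 27 , 34 , 69 ⟩ ∷ ⟨0, 4 , 68 , 74 ⟩ ∷ ⟨0, 21 , 41 , 67 ⟩ ∷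
  ⟨0, 5 , 56 , 65 ⟩ ∷ ⟨0, 8 , 39 , 57 ⟩ ∷ ⟨0, 10 , 50 , 63 ⟩ ∷ ⟨0, 15 , 37 , 73 ⟩ ∷
  ⟨0, 11 , 54 , 66 ⟩ ∷ ⟨0, 19 , 33 , 71 ⟩ ∷ ⟨0, 3 , 32 , 62 ⟩ ∷ ⟨0, 16 , 44 , 61 ⟩ ∷ []

system₁₃ : List (List ℕ)
system₁₃ =
  ⟨0, 21 , 55 , 78 ⟩ ∷ ⟨0, 27 , 49 , 74 ⟩ ∷ ⟨0, 6 , 11 , 75 ⟩ ∷ ⟨0, 30 , 58 , 71 ⟩ ∷
  ⟨0, 17 , 67 , 79 ⟩ ∷ ⟨0, 26 , 61 , 65 ⟩ ∷ ⟨0, 29 , 53 , 72 ⟩ ∷ ⟨0, 16 , 68 , 76 ⟩ ∷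
  ⟨0, 15 , 46 , 66 ⟩ ∷ ⟨0, 9 , 45 , 63 ⟩ ∷ ⟨0, 3 , 59 , 73 ⟩ ∷ ⟨0, 32 , 42 , 80 ⟩ ∷
  ⟨0, 37 , 44 , 77 ⟩ ∷ []

system₁₄ : List (List ℕ)
system₁₄ =
  ⟨0, 8 , 71 , 84 ⟩ ∷ ⟨0, 21 , 51 , 80 ⟩ ∷ ⟨0, 4 , 46 , 85 ⟩ ∷ ⟨0, 18 , 54 , 86 ⟩ ∷
  ⟨0, 17 , 24 , 79 ⟩ ∷ ⟨0, 14 , 40 , 74 ⟩ ∷ ⟨0, 12 , 57 , 77 ⟩ ∷ ⟨0, 16 , 47 , 82 ⟩ ∷
  ⟨0, 10 , 33 , 83 ⟩ ∷ ⟨0, 5 , 48 , 75 ⟩ ∷ ⟨0, 11 , 49 , 64 ⟩ ∷ ⟨0, 22 , 41 , 78 ⟩ ∷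
  ⟨0, 3 , 28 , 72 ⟩ ∷ ⟨0, 6 , 58 , 67 ⟩ ∷ []

system₁₅ : List (List ℕ)
system₁₅ =
  ⟨0, 10 , 66 , 90 ⟩ ∷ ⟨0, 11 , 75 , 89 ⟩ ∷ ⟨0, 4 , 39 , 91 ⟩ ∷ ⟨0, 15 , 58 , 84 ⟩ ∷
  ⟨0, 13 , 53 , 81 ⟩ ∷ ⟨0, 18 , 34 , 72 ⟩ ∷ ⟨0, 23 , 55 , 85 ⟩ ∷ ⟨0, 7 , 67 , 86 ⟩ ∷
  ⟨0, 9 , 50 , 83 ⟩ ∷ ⟨0, 21 , 70 , 92 ⟩ ∷ ⟨0, 25 , 61 , 88 ⟩ ∷ ⟨0, 3 , 47 , 76 ⟩ ∷
  ⟨0, 6 , 48 , 65 ⟩ ∷ ⟨0, 5 , 51 , 82 ⟩ ∷ ⟨0, 12 , 20 , 57 ⟩ ∷ []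

system₁₆ : List (List ℕ)
system₁₆ =
  ⟨0, 11 , 57 , 96 ⟩ ∷ ⟨0, 8 , 74 , 94 ⟩ ∷ ⟨0, 22 , 72 , 98 ⟩ ∷ ⟨0, 24 , 67 , 95 ⟩ ∷
  ⟨0, 3 , 81 , 90 ⟩ ∷ ⟨0, 35 , 53 , 91 ⟩ ∷ ⟨0, 15 , 36 , 97 ⟩ ∷ ⟨0, 12 , 64 , 80 ⟩ ∷
  ⟨0, 14 , 59 , 93 ⟩ ∷ ⟨0, 27 , 40 , 89 ⟩ ∷ ⟨0, 5 , 65 , 75 ⟩ ∷ ⟨0, 25 , 42 , 83 ⟩ ∷
  ⟨0, 6 , 37 , 69 ⟩ ∷ ⟨0, 19 , 48 , 92 ⟩ ∷ ⟨0, 4 , 55 , 88 ⟩ ∷ ⟨0, 23 , 30 , 77 ⟩ ∷ []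

psds-4-3-table : All PSDS-4-3 (applyUpTo (5 +_) 12)
psds-4-3-table =
    (_ , psds-bySorting system₅ refl refl)
  ∷ (_ , psds-bySorting system₆ refl refl)
  ∷ (_ , psds-bySorting system₇ refl refl)
  ∷ (_ , psds-bySorting system₈ refl refl)
  ∷ (_ , psds-bySorting system₉ refl refl)
  ∷ (_ , psds-bySorting system₁₀ refl refl)
  ∷ (_ , psds-bySorting system₁₁ refl refl)
  ∷ (_ , psds-bySorting system₁₂ refl refl)
  ∷ (_ , psds-bySorting system₁₃ refl refl)
  ∷ (_ , psds-bySorting system₁₄ refl refl)
  ∷ (_ , psds-bySorting system₁₅ refl refl)
  ∷ (_ , psds-bySorting system₁₆ refl refl)
  ∷ []

lemma4p1 : (m : ℕ) → 5 ≤ m → m ≤ 16 → Σ (List (List ℕ)) (λ 𝒜 → PSDS m 4 3 𝒜)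
lemma4p1 m 5≤m m≤16 =
  subst PSDS-4-3 (m+[n∸m]≡n 5≤m)
    (All.lookup psds-4-3-table (∈-applyUpTo⁺ (5 +_) (s≤s (∸-monoˡ-≤ 5 m≤16))))
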